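{- In an efficient enhanced Gelfand--Zetlin pattern, the set of edges is uniquely determined by the underlying Gelfand--Zetlin pattern and the set of encircled entries; i.e., two efficient enhanced patterns with the same entries and the same encircled entries have the same edges.
   Context: $\lambda=(\lambda_1\ge\dots\ge\lambda_n)$ is a partition. A Gelfand--Zetlin pattern is an integer array $(a_{ij})_{0\le i\le n-1,\,1\le j\le n-i}$ with $a_{0j}=\lambda_{n+1-j}$ and $a_{i-1,j}\le a_{ij}\le a_{i-1,j+1}$. Neighbors: $a_{ij}$ with $a_{i-1,j}$, and $a_{ij}$ with $a_{i-1,j+1}$. Triangle: top-left $a_{i-1,j}$, top-right $a_{i-1,j+1}$, bottom $a_{ij}$. An enhanced pattern is a GZ pattern with some entries encircled and some neighbor pairs joined by edges such that: (1) row-$0$ entries encircled; (2) edge-joined entries equal, lower one encircled; (3) for $1\le i\le n-2$, $a_{ij},a_{i,j+1}$ both joined to $a_{i-1,j+1}$ iff both joined to $a_{i+1,j}$; (4) if $a_{0j}=a_{0,j+1}$, $a_{1j}$ is encircled and joined to both; (5) triangle top-left $a$, top-right $b>a$, bottom $a$: bottom encircled and joined to top-left; (6) triangle top-left $a$, top-right $b>a$, bottom $b$ encircled: bottom joined to top-right; (7) all-equal triangle with top entries connected by a path of edges: bottom encircled and joined to both; (8) all-equal triangle with encircled bottom: bottom joined to at least one top entry. It is efficient if it has no triangle with all three entries equal whose bottom is not joined by an edge to the top-right entry. -}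

module Defs where

open import Data.Nat using (ℕ; zero; suc; _+_; _∸_; _≤_; _<_)
open import Data.Bool using (Bool; T)
open import Data.Product using (_×_; _,_)
open import Data.Sum using (_⊎_)
open import Relation.Binary.PropositionalEquality using (_≡_)
open import Relation.Binary.Construct.Closure.ReflexiveTransitive using (Star)
open import Function.Bundles using (_⇔_)

-- A (candidate) Gelfand--Zetlin pattern of size n is a function a : ℕ → ℕ → ℕ,
-- a i j standing for a_{ij}; only "valid" positions matter:
--   0 ≤ i ≤ n-1, 1 ≤ j ≤ n-i   i.e.   1 ≤ j  and  i + j ≤ n.
-- A partition λ = (λ_1 ≥ … ≥ λ_n) is a function ℕ → ℕ, λ k for 1 ≤ k ≤ n.
-- Entries are natural numbers (the parts of a partition are ≥ 0 and all
-- entries of a GZ pattern lie between λ_n and λ_1).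

Valid : ℕ → ℕ → ℕ → Set
Valid n i j = (1 ≤ j) × (i + j ≤ n)

IsPartition : (n : ℕ) → (ℕ → ℕ) → Set
IsPartition n λ′ = ∀ k → 1 ≤ k → suc k ≤ n → λ′ (suc k) ≤ λ′ k

-- Gelfand--Zetlin pattern with top row λ:
--   a_{0j} = λ_{n+1-j}, and a_{i-1,j} ≤ a_{ij} ≤ a_{i-1,j+1}.
-- We write the lower row index as suc k (so k = i-1).
IsGZ : (n : ℕ) → (ℕ → ℕ) → (ℕ → ℕ → ℕ) → Set
IsGZ n λ′ a =
  (∀ j → Valid n 0 j → a 0 j ≡ λ′ (suc n ∸ j)) ×
  (∀ k j → Valid n (suc k) j → (a k j ≤ a (suc k) j) × (a (suc k) j ≤ a k (suc j)))

-- Decorations of a pattern: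
--   circ i j      : a_{ij} is encircled
--   eL k j        : edge joining a_{k+1,j} with a_{k,j}      (top-left neighbour)
--   eR k j        : edge joining a_{k+1,j} with a_{k,j+1}    (top-right neighbour)
-- Only values at valid positions are meaningful.
record Decoration : Set where
  field
    circ : ℕ → ℕ → Bool
    eL   : ℕ → ℕ → Bool
    eR   : ℕ → ℕ → Bool
open Decoration public

Pos : Set
Pos = ℕ × ℕ

data EdgeStep (n : ℕ) (d : Decoration) : Pos → Pos → Set where
  L↑ : ∀ k j → Valid n (suc k) j → T (eL d k j) → EdgeStep n d (suc k , j) (k , j)
  L↓ : ∀ k j → Valid n (suc k) j → T (eL d k j) → EdgeStep n d (k , j) (suc k , j)
  R↑ : ∀ k j → Valid n (suc k) j → T (eR d k j) → EdgeStep n d (suc k , j) (k , suc j)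
  R↓ : ∀ k j → Valid n (suc k) j → T (eR d k j) → EdgeStep n d (k , suc j) (suc k , j)

Connected : (n : ℕ) → Decoration → Pos → Pos → Set
Connected n d = Star (EdgeStep n d)

-- Enhanced pattern: conditions (1)–(8) of the paper.
-- The triangle indexed by (k , j) (with Valid n (suc k) j) has
-- top-left a k j, top-right a k (suc j), bottom a (suc k) j.
IsEnhanced : (n : ℕ) → (ℕ → ℕ → ℕ) → Decoration → Set
IsEnhanced n a d =
  (∀ j → Valid n 0 j → T (circ d 0 j)) ×
  (∀ k j → Valid n (suc k) j → T (eL d k j) → (a (suc k) j ≡ a k j) × T (circ d (suc k) j)) ×
  (∀ k j → Valid n (suc k) j → T (eR d k j) → (a (suc k) j ≡ a k (suc j)) × T (circ d (suc k) j)) ×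
  -- (3) for 1 ≤ i ≤ n-2 (here i = suc k): a_{ij}, a_{i,j+1} both joined to a_{i-1,j+1}
  --     iff both joined to a_{i+1,j}
  (∀ k j → Valid n (suc (suc k)) j →
     (T (eR d k j) × T (eL d k (suc j))) ⇔ (T (eL d (suc k) j) × T (eR d (suc k) j))) ×
  (∀ j → Valid n 1 j → a 0 j ≡ a 0 (suc j) →
     T (circ d 1 j) × T (eL d 0 j) × T (eR d 0 j)) ×
  (∀ k j → Valid n (suc k) j → a k j < a k (suc j) → a (suc k) j ≡ a k j →
     T (circ d (suc k) j) × T (eL d k j)) ×
  (∀ k j → Valid n (suc k) j → a k j < a k (suc j) → a (suc k) j ≡ a k (suc j) →
     T (circ d (suc k) j) → T (eR d k j)) ×
  (∀ k j → Valid n (suc k) j → a k j ≡ a k (suc j) → a (suc k) j ≡ a k j →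
     Connected n d (k , j) (k , suc j) →
     T (circ d (suc k) j) × T (eL d k j) × T (eR d k j)) ×
  (∀ k j → Valid n (suc k) j → a k j ≡ a k (suc j) → a (suc k) j ≡ a k j →
     T (circ d (suc k) j) → T (eL d k j) ⊎ T (eR d k j))

IsEfficient : (n : ℕ) → (ℕ → ℕ → ℕ) → Decoration → Set
IsEfficient n a d =
  ∀ k j → Valid n (suc k) j → a k j ≡ a k (suc j) → a (suc k) j ≡ a k j → T (eR d k j)

-- Going down the rows, every edge is forced by the entries and the circles.
-- An edge from a bottom entry to its top-right neighbour exists exactly when
-- the two are equal and, unless the triangle is all-equal (efficiency), the
-- bottom is encircled (conditions (2), (6)).  An edge to the top-left
-- neighbour exists exactly when the two are equal and either the top-right
-- entry is larger (5), or we are in row 1 (4), or, in an all-equal triangle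
-- below row 1, the rhombus rule (3), whose lower right edge exists by
-- efficiency, ties it to two edges of the row above, known by induction.
module Submission where

open import Defs
open import Data.Nat using (ℕ; zero; suc; _≤_; _<_; s≤s; z≤n)
open import Data.Nat.Properties using (≤-trans; n≤1+n; +-suc; m≤n⇒m<n∨m≡n)
open import Data.Bool using (Bool; true; false; T)
open import Data.Empty using (⊥-elim)
open import Data.Product using (_×_; _,_; proj₁; proj₂)
open import Data.Sum using (inj₁; inj₂)
open import Relation.Binary.PropositionalEquality using (_≡_; refl; sym; trans; subst)
open import Function.Bundles using (Equivalence)

T-injective : {b₁ b₂ : Bool} → (T b₁ → T b₂) → (T b₂ → T b₁) → b₁ ≡ b₂
T-injective {false} {false} _ _ = refl
T-injective {false} {true}  _ g = ⊥-elim (g _)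
T-injective {true}  {false} f _ = ⊥-elim (f _)
T-injective {true}  {true}  _ _ = refl

Valid-pred-row : ∀ {n i j} → Valid n (suc i) j → Valid n i j
Valid-pred-row (1≤j , in-range) = 1≤j , ≤-trans (n≤1+n _) in-range

Valid-shift-up-right : ∀ {n i j} → Valid n (suc i) j → Valid n i (suc j)
Valid-shift-up-right {n} {i} {j} (_ , in-range) = s≤s z≤n , subst (_≤ n) (sym (+-suc i j)) in-range

module _ {n : ℕ} {a : ℕ → ℕ → ℕ} {d : Decoration} (E : IsEnhanced n a d) where

  joinedˡ⇒equal : ∀ {k j} → Valid n (suc k) j → T (eL d k j) → a (suc k) j ≡ a k j
  joinedˡ⇒equal v e = proj₁ (proj₁ (proj₂ E) _ _ v e)

  joinedʳ⇒equal×circled : ∀ {k j} → Valid n (suc k) j → T (eR d k j) →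
                          (a (suc k) j ≡ a k (suc j)) × T (circ d (suc k) j)
  joinedʳ⇒equal×circled = proj₁ (proj₂ (proj₂ E)) _ _

  rhombus-rule : ∀ {k j} → Valid n (suc (suc k)) j →
                 T (eL d (suc k) j) → T (eR d (suc k) j) → T (eR d k j) × T (eL d k (suc j))
  rhombus-rule v l r = Equivalence.from (proj₁ (proj₂ (proj₂ (proj₂ E))) _ _ v) (l , r)

  rhombus-rule⁻¹ : ∀ {k j} → Valid n (suc (suc k)) j →
                   T (eR d k j) → T (eL d k (suc j)) → T (eL d (suc k) j)
  rhombus-rule⁻¹ v r l = proj₁ (Equivalence.to (proj₁ (proj₂ (proj₂ (proj₂ E))) _ _ v) (r , l))

  equal-top⇒joinedˡ : ∀ {j} → Valid n 1 j → a 0 j ≡ a 0 (suc j) → T (eL d 0 j)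
  equal-top⇒joinedˡ v eq = proj₁ (proj₂ (proj₁ (proj₂ (proj₂ (proj₂ (proj₂ E)))) _ v eq))

  strict-top⇒joinedˡ : ∀ {k j} → Valid n (suc k) j → a k j < a k (suc j) →
                       a (suc k) j ≡ a k j → T (eL d k j)
  strict-top⇒joinedˡ v lt eq = proj₂ (proj₁ (proj₂ (proj₂ (proj₂ (proj₂ (proj₂ E))))) _ _ v lt eq)

  strict-top⇒circled⇒joinedʳ : ∀ {k j} → Valid n (suc k) j → a k j < a k (suc j) →
                               a (suc k) j ≡ a k (suc j) → T (circ d (suc k) j) → T (eR d k j)
  strict-top⇒circled⇒joinedʳ = proj₁ (proj₂ (proj₂ (proj₂ (proj₂ (proj₂ (proj₂ E)))))) _ _

module Transfer {n : ℕ} {λ′ : ℕ → ℕ} {a : ℕ → ℕ → ℕ} (G : IsGZ n λ′ a) {dA dB : Decoration}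
         (EA : IsEnhanced n a dA) (FA : IsEfficient n a dA)
         (EB : IsEnhanced n a dB) (FB : IsEfficient n a dB)
         (same-circles : ∀ i j → Valid n i j → circ dA i j ≡ circ dB i j) where

  top-left≤top-right : ∀ {k j} → Valid n (suc k) j → a k j ≤ a k (suc j)
  top-left≤top-right v = ≤-trans (proj₁ (proj₂ G _ _ v)) (proj₂ (proj₂ G _ _ v))

  joinedʳ-transfer : ∀ {k j} → Valid n (suc k) j → T (eR dA k j) → T (eR dB k j)
  joinedʳ-transfer {k} {j} v e
    with bottom≡right , circledA ← joinedʳ⇒equal×circled EA v e
       | m≤n⇒m<n∨m≡n (top-left≤top-right v)
  ... | inj₁ left<right = strict-top⇒circled⇒joinedʳ EB v left<right bottom≡right
                            (subst T (same-circles _ _ v) circledA)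
  ... | inj₂ left≡right = FB k j v left≡right (trans bottom≡right (sym left≡right))

  joinedˡ-transfer : ∀ k {j} → Valid n (suc k) j → T (eL dA k j) → T (eL dB k j)
  joinedˡ-transfer k v e with m≤n⇒m<n∨m≡n (top-left≤top-right v)
  ... | inj₁ left<right = strict-top⇒joinedˡ EB v left<right (joinedˡ⇒equal EA v e)
  joinedˡ-transfer zero    v e | inj₂ left≡right = equal-top⇒joinedˡ EB v left≡right
  joinedˡ-transfer (suc k) {j} v e | inj₂ left≡right =
    rhombus-rule⁻¹ EB v (joinedʳ-transfer (Valid-pred-row v) (proj₁ upper))
                        (joinedˡ-transfer k (Valid-shift-up-right v) (proj₂ upper))
    where
    all-equal : a (suc (suc k)) j ≡ a (suc k) j
    all-equal = joinedˡ⇒equal EA v e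

    upper : T (eR dA k j) × T (eL dA k (suc j))
    upper = rhombus-rule EA v e (FA (suc k) j v left≡right all-equal)

lemma4p8 : (n : ℕ) (λ′ : ℕ → ℕ) (a : ℕ → ℕ → ℕ) (d₁ d₂ : Decoration) →
    IsPartition n λ′ → IsGZ n λ′ a →
    IsEnhanced n a d₁ → IsEfficient n a d₁ →
    IsEnhanced n a d₂ → IsEfficient n a d₂ →
    (∀ i j → Valid n i j → circ d₁ i j ≡ circ d₂ i j) →
    ∀ k j → Valid n (suc k) j → (eL d₁ k j ≡ eL d₂ k j) × (eR d₁ k j ≡ eR d₂ k j)
lemma4p8 n λ′ a d₁ d₂ _ G E₁ F₁ E₂ F₂ same k j v =
    T-injective (T₁₂.joinedˡ-transfer k v) (T₂₁.joinedˡ-transfer k v)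
  , T-injective (T₁₂.joinedʳ-transfer v) (T₂₁.joinedʳ-transfer v)
  where
  module T₁₂ = Transfer {λ′ = λ′} {a = a} G E₁ F₁ E₂ F₂ same
  module T₂₁ = Transfer {λ′ = λ′} {a = a} G E₂ F₂ E₁ F₁ (λ i j v → sym (same i j v))
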